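{- Let $X$ be a simplicial complex and let $0\le\ell<k\le\dim(X)$. Let $\eta\in X(\ell)$ and $\sigma,\tau\in X_\eta(k)$ with $|\sigma\cap\tau|=k$. Then \[ (\sigma:\sigma\cap\tau)(\tau:\sigma\cap\tau)=\binom{k+1}{\ell+1}\cdot s_\eta(\sigma)s_\eta(\tau)\cdot(\sigma\setminus\eta:(\sigma\cap\tau)\setminus\eta)\cdot(\tau\setminus\eta:(\sigma\cap\tau)\setminus\eta). \]
   Context: A simplicial complex $X$ on a finite vertex set $V$ is a family of subsets of $V$ closed under taking subsets; $X(k)$ is the set of its $k$-dimensional faces (faces of size $k+1$). Fix a linear order $<$ on $V$. For finite sets $\alpha\subset\beta$ of vertices with $|\beta\setminus\alpha|=1$, let $(\beta:\alpha)=(-1)^{|\{v\in\beta:\,v<u\}|}$, where $u$ is the unique element of $\beta\setminus\alpha$. For $\eta\in X(\ell)$, let $X_\eta(k)=\{\sigma\in X(k):\,\eta\subset\sigma\}$, and for $\sigma\in X_\eta(k)$ let $s_\eta(\sigma)=\binom{k+1}{\ell+1}^{ -1/2}(-1)^{|\{(i,j):\,i\in\sigma\setminus\eta,\ j\in\eta,\ i>j\}|}$. -}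

module Defs where

open import Level using (Level)
open import Data.Nat using (ℕ; zero; suc; _<ᵇ_)
open import Data.Nat.Combinatorics using (_C_)
open import Data.Bool using (Bool; true; false; if_then_else_)
open import Data.Fin using (Fin; toℕ)
open import Data.Fin.Subset using (Subset; _⊆_; _∩_; _─_; ∣_∣)
open import Data.Vec using (tabulate; lookup)
open import Data.List using (List; map)
open import Data.Nat.ListAction using (sum)
open import Data.List using (allFin)
open import Relation.Binary.PropositionalEquality using (_≡_)
open import Data.Product using (_×_)
open import Algebra.Bundles using (CommutativeRing)

-- Vertex set V = Fin n with its natural linear order; faces are subsets of Fin n.

IsSimplicialComplex : ∀ {n} → (Subset n → Set) → Set
IsSimplicialComplex {n} X = ∀ (σ τ : Subset n) → τ ⊆ σ → X σ → X τ

InX : ∀ {n} → (Subset n → Set) → ℕ → Subset n → Set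
InX X k σ = X σ × ∣ σ ∣ ≡ suc k

InXη : ∀ {n} → (Subset n → Set) → Subset n → ℕ → Subset n → Set
InXη X η k σ = InX X k σ × η ⊆ σ

below : ∀ {n} → Fin n → Subset n
below u = tabulate (λ v → toℕ v <ᵇ toℕ u)

countBelow : ∀ {n} → Subset n → Fin n → ℕ
countBelow A u = ∣ A ∩ below u ∣

sumOver : ∀ {n} → Subset n → (Fin n → ℕ) → ℕ
sumOver {n} S f = sum (map (λ i → if lookup S i then f i else 0) (allFin n))

-- exponent of (β:α): #{v ∈ β : v < u} where u is the unique element of β∖α
-- (written as a sum over β∖α, which is that single term when |β∖α| = 1)
incExp : ∀ {n} → Subset n → Subset n → ℕ
incExp β α = sumOver (β ─ α) (countBelow β)

-- exponent of the sign in s_η(σ): #{(i,j) : i ∈ σ∖η, j ∈ η, i > j}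
sExp : ∀ {n} → Subset n → Subset n → ℕ
sExp η σ = sumOver (σ ─ η) (countBelow η)

module _ {a b : Level} (R : CommutativeRing a b) where
  open CommutativeRing R

  negOnePow : ℕ → Carrier
  negOnePow zero = 1#
  negOnePow (suc m) = - (negOnePow m)

  natR : ℕ → Carrier
  natR zero = 0#
  natR (suc m) = 1# + natR m

  incidence : ∀ {n} → Subset n → Subset n → Carrier
  incidence β α = negOnePow (incExp β α)

  -- s_η(σ) for σ of dimension k, given r playing the role of binom(k+1,ℓ+1)^{-1/2}
  sη : ∀ {n} → Carrier → Subset n → Subset n → Carrier
  sη r η σ = r * negOnePow (sExp η σ)

-- Write ρ = σ ∩ τ. For u ∈ σ ∖ ρ, the vertices of σ below u are those of σ ∖ η below u
-- together with those of η below u; summing over u splits the exponent of (σ : ρ) into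
-- that of (σ ∖ η : ρ ∖ η) plus the part of the exponent of s_η(σ) contributed by σ ∖ ρ.
-- The rest of that exponent is the exponent of s_η(ρ), which occurs once for σ and once
-- for τ and so cancels in the sign, while the normalisations multiply to binom(k+1,l+1)⁻¹.
module Submission where

open import Defs
open import Level using (Level)
open import Data.Nat using (ℕ; suc; _<_; _+_)
open import Data.Nat.Combinatorics using (_C_)
open import Data.Nat.Properties using (+-suc; +-identityʳ; +-commutativeSemigroup)
open import Data.Nat.ListAction using (sum)
open import Data.Bool using (if_then_else_)
open import Data.Fin using (Fin; zero; suc)
open import Data.Fin.Subset using (Subset; inside; outside; _⊆_; _∩_; _─_; ∣_∣)
open import Data.Fin.Subset.Properties using (drop-∷-⊆; p∩q⊆p; p∩q⊆q; x∈p∩q⁺)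
open import Data.Vec using ([]; _∷_; lookup; here)
open import Data.List using (allFin; map; tabulate)
open import Data.List.Properties using (map-tabulate; map-cong)
open import Data.Product using (_,_)
open import Function using (id; _∘_)
open import Relation.Nullary using (contradiction)
open import Relation.Binary.PropositionalEquality using (_≡_; refl; sym; trans; cong; cong₂; module ≡-Reasoning)
open import Algebra.Bundles using (CommutativeRing)
open import Algebra.Properties.CommutativeSemigroup +-commutativeSemigroup using (xy∙z≈yz∙x) renaming (interchange to +-interchange)

sumOver-∷ : ∀ {n} s (S : Subset n) (f : Fin (suc n) → ℕ) →
            sumOver (s ∷ S) f ≡ (if s then f zero else 0) + sumOver S (f ∘ suc)
sumOver-∷ {n} s S f = cong ((if s then f zero else 0) +_) (cong sum (begin
  map F (tabulate suc)       ≡⟨ map-tabulate suc F ⟩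
  tabulate (F ∘ suc)         ≡⟨ map-tabulate id (F ∘ suc) ⟨
  map (F ∘ suc) (allFin n)   ∎))
  where
  open ≡-Reasoning
  F : Fin (suc n) → ℕ
  F i = if lookup (s ∷ S) i then f i else 0

sumOver-∷-+ : ∀ {n} a b c (A B D : Subset n) (f g h : Fin (suc n) → ℕ) →
              (if a then f zero else 0) ≡ (if b then g zero else 0) + (if c then h zero else 0) →
              sumOver A (f ∘ suc) ≡ sumOver B (g ∘ suc) + sumOver D (h ∘ suc) →
              sumOver (a ∷ A) f ≡ sumOver (b ∷ B) g + sumOver (c ∷ D) h
sumOver-∷-+ a b c A B D f g h heads tails = begin
  sumOver (a ∷ A) f                     ≡⟨ sumOver-∷ a A f ⟩
  fa + sumOver A (f ∘ suc)              ≡⟨ cong₂ _+_ heads tails ⟩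
  (gb + hc) + (gB + hD)                 ≡⟨ +-interchange gb hc gB hD ⟩
  (gb + gB) + (hc + hD)                 ≡⟨ cong₂ _+_ (sumOver-∷ b B g) (sumOver-∷ c D h) ⟨
  sumOver (b ∷ B) g + sumOver (c ∷ D) h ∎
  where
  open ≡-Reasoning
  fa gb hc gB hD : ℕ
  fa = if a then f zero else 0
  gb = if b then g zero else 0
  hc = if c then h zero else 0
  gB = sumOver B (g ∘ suc)
  hD = sumOver D (h ∘ suc)

sumOver-+ : ∀ {n} (S : Subset n) (f g : Fin n → ℕ) →
            sumOver S (λ i → f i + g i) ≡ sumOver S f + sumOver S g
sumOver-+ []      f g = refl
sumOver-+ (s ∷ S) f g =
  sumOver-∷-+ s s s S S S _ f g (heads s) (sumOver-+ S (f ∘ suc) (g ∘ suc))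
  where
  heads : ∀ b → (if b then f zero + g zero else 0) ≡ (if b then f zero else 0) + (if b then g zero else 0)
  heads inside  = refl
  heads outside = refl

sumOver-cong : ∀ {n} (S : Subset n) {f g : Fin n → ℕ} → (∀ i → f i ≡ g i) →
               sumOver S f ≡ sumOver S g
sumOver-cong {n} S f≗g =
  cong sum (map-cong (λ i → cong (if lookup S i then_else 0) (f≗g i)) (allFin n))

sumOver-─-telescope : ∀ {n} {A F E : Subset n} (f : Fin n → ℕ) → E ⊆ F → F ⊆ A →
                      sumOver (A ─ E) f ≡ sumOver (A ─ F) f + sumOver (F ─ E) f
sumOver-─-telescope {A = []} {[]} {[]} f E⊆F F⊆A = refl
sumOver-─-telescope {A = inside ∷ A} {inside ∷ F} {inside ∷ E} f E⊆F F⊆A =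
  sumOver-∷-+ outside outside outside (A ─ E) (A ─ F) (F ─ E) f f f refl
    (sumOver-─-telescope (f ∘ suc) (drop-∷-⊆ E⊆F) (drop-∷-⊆ F⊆A))
sumOver-─-telescope {A = inside ∷ A} {inside ∷ F} {outside ∷ E} f E⊆F F⊆A =
  sumOver-∷-+ inside outside inside (A ─ E) (A ─ F) (F ─ E) f f f refl
    (sumOver-─-telescope (f ∘ suc) (drop-∷-⊆ E⊆F) (drop-∷-⊆ F⊆A))
sumOver-─-telescope {A = a ∷ A} {outside ∷ F} {outside ∷ E} f E⊆F F⊆A =
  sumOver-∷-+ a a outside (A ─ E) (A ─ F) (F ─ E) f f f (sym (+-identityʳ _))
    (sumOver-─-telescope (f ∘ suc) (drop-∷-⊆ E⊆F) (drop-∷-⊆ F⊆A))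
sumOver-─-telescope {A = outside ∷ A} {inside ∷ F} f E⊆F F⊆A = contradiction (F⊆A here) λ ()
sumOver-─-telescope {F = outside ∷ F} {inside ∷ E} f E⊆F F⊆A = contradiction (E⊆F here) λ ()

─-─-cancel : ∀ {n} (A : Subset n) {F E : Subset n} → E ⊆ F → (A ─ E) ─ (F ─ E) ≡ A ─ F
─-─-cancel []      {[]}          {[]}          E⊆F = refl
─-─-cancel (a ∷ A) {f ∷ F}       {outside ∷ E} E⊆F = cong₂ _∷_ refl (─-─-cancel A (drop-∷-⊆ E⊆F))
─-─-cancel (a ∷ A) {inside ∷ F}  {inside ∷ E}  E⊆F = cong₂ _∷_ refl (─-─-cancel A (drop-∷-⊆ E⊆F))
─-─-cancel (a ∷ A) {outside ∷ F} {inside ∷ E}  E⊆F = contradiction (E⊆F here) λ ()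

∣∩∣-─-split : ∀ {n} {A E : Subset n} (B : Subset n) → E ⊆ A →
              ∣ A ∩ B ∣ ≡ ∣ (A ─ E) ∩ B ∣ + ∣ E ∩ B ∣
∣∩∣-─-split {A = []} {[]} [] E⊆A = refl
∣∩∣-─-split {A = inside ∷ A} {inside ∷ E} (inside ∷ B) E⊆A =
  trans (cong suc (∣∩∣-─-split B (drop-∷-⊆ E⊆A))) (sym (+-suc _ _))
∣∩∣-─-split {A = inside ∷ A} {inside ∷ E} (outside ∷ B) E⊆A = ∣∩∣-─-split B (drop-∷-⊆ E⊆A)
∣∩∣-─-split {A = inside ∷ A} {outside ∷ E} (inside ∷ B) E⊆A = cong suc (∣∩∣-─-split B (drop-∷-⊆ E⊆A))
∣∩∣-─-split {A = inside ∷ A} {outside ∷ E} (outside ∷ B) E⊆A = ∣∩∣-─-split B (drop-∷-⊆ E⊆A)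
∣∩∣-─-split {A = outside ∷ A} {outside ∷ E} (b ∷ B) E⊆A = ∣∩∣-─-split B (drop-∷-⊆ E⊆A)
∣∩∣-─-split {A = outside ∷ A} {inside ∷ E} B E⊆A = contradiction (E⊆A here) λ ()

incExp-─-split : ∀ {n} {A F E : Subset n} → E ⊆ A → E ⊆ F →
                 incExp A F ≡ incExp (A ─ E) (F ─ E) + sumOver (A ─ F) (countBelow E)
incExp-─-split {A = A} {F} {E} E⊆A E⊆F = begin
  sumOver (A ─ F) (countBelow A)
    ≡⟨ sumOver-cong (A ─ F) (λ u → ∣∩∣-─-split (below u) E⊆A) ⟩
  sumOver (A ─ F) (λ u → countBelow (A ─ E) u + countBelow E u)
    ≡⟨ sumOver-+ (A ─ F) (countBelow (A ─ E)) (countBelow E) ⟩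
  sumOver (A ─ F) (countBelow (A ─ E)) + sumOver (A ─ F) (countBelow E)
    ≡⟨ cong (λ S → sumOver S (countBelow (A ─ E)) + sumOver (A ─ F) (countBelow E)) (─-─-cancel A E⊆F) ⟨
  sumOver ((A ─ E) ─ (F ─ E)) (countBelow (A ─ E)) + sumOver (A ─ F) (countBelow E) ∎
  where open ≡-Reasoning

incExp-sExp-exchange : ∀ {n} {η ρ σ : Subset n} → η ⊆ ρ → ρ ⊆ σ →
                       incExp σ ρ + sExp η ρ ≡ sExp η σ + incExp (σ ─ η) (ρ ─ η)
incExp-sExp-exchange {η = η} {ρ} {σ} η⊆ρ ρ⊆σ = begin
  incExp σ ρ + sExp η ρ        ≡⟨ cong (_+ sExp η ρ) (incExp-─-split (ρ⊆σ ∘ η⊆ρ) η⊆ρ) ⟩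
  (relative + outer) + inner   ≡⟨ xy∙z≈yz∙x relative outer inner ⟩
  (outer + inner) + relative   ≡⟨ cong (_+ relative) (sumOver-─-telescope (countBelow η) η⊆ρ ρ⊆σ) ⟨
  sExp η σ + relative          ∎
  where
  open ≡-Reasoning
  relative outer inner : ℕ
  relative = incExp (σ ─ η) (ρ ─ η)
  outer    = sumOver (σ ─ ρ) (countBelow η)
  inner    = sExp η ρ

module Signs {a b : Level} (R : CommutativeRing a b) where

  open CommutativeRing R hiding (_+_)
  open import Algebra.Properties.Ring ring using (-‿distribˡ-*; -‿distribʳ-*; -‿involutive)
  open import Algebra.Properties.CommutativeSemigroup *-commutativeSemigroup using (interchange)
  open import Relation.Binary.Reasoning.Setoid setoid

  negOnePow-+ : ∀ m n → negOnePow R (m + n) ≈ negOnePow R m * negOnePow R n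
  negOnePow-+ 0       n = begin
    negOnePow R n                         ≈⟨ *-identityˡ (negOnePow R n) ⟨
    1# * negOnePow R n                    ∎
  negOnePow-+ (suc m) n = begin
    - negOnePow R (m + n)                 ≈⟨ -‿cong (negOnePow-+ m n) ⟩
    - (negOnePow R m * negOnePow R n)     ≈⟨ -‿distribˡ-* _ _ ⟩
    (- negOnePow R m) * negOnePow R n     ∎

  negOnePow-square : ∀ m → negOnePow R m * negOnePow R m ≈ 1#
  negOnePow-square 0       = *-identityˡ 1#
  negOnePow-square (suc m) = begin
    (- s) * (- s)   ≈⟨ -‿distribˡ-* s (- s) ⟨
    - (s * - s)     ≈⟨ -‿cong (-‿distribʳ-* s s) ⟨
    - - (s * s)     ≈⟨ -‿involutive (s * s) ⟩
    s * s           ≈⟨ negOnePow-square m ⟩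
    1#              ∎
    where s = negOnePow R m

  x*y≈[x*u]*[y*u] : ∀ {u} x y → u * u ≈ 1# → x * y ≈ (x * u) * (y * u)
  x*y≈[x*u]*[y*u] {u} x y u²≈1 = begin
    x * y               ≈⟨ *-identityʳ (x * y) ⟨
    (x * y) * 1#        ≈⟨ *-congˡ u²≈1 ⟨
    (x * y) * (u * u)   ≈⟨ interchange x y u u ⟩
    (x * u) * (y * u)   ∎

  K*[r*x*[r*y]]≈x*y : ∀ {K r} x y → (r * r) * K ≈ 1# → K * ((r * x) * (r * y)) ≈ x * y
  K*[r*x*[r*y]]≈x*y {K} {r} x y r²K≈1 = begin
    K * ((r * x) * (r * y))   ≈⟨ *-congˡ (interchange r x r y) ⟩
    K * ((r * r) * (x * y))   ≈⟨ *-assoc K (r * r) (x * y) ⟨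
    (K * (r * r)) * (x * y)   ≈⟨ *-congʳ (*-comm K (r * r)) ⟩
    ((r * r) * K) * (x * y)   ≈⟨ *-congʳ r²K≈1 ⟩
    1# * (x * y)              ≈⟨ *-identityˡ (x * y) ⟩
    x * y                     ∎

  incidence-sign-exchange : ∀ {n} {η ρ σ : Subset n} → η ⊆ ρ → ρ ⊆ σ →
    incidence R σ ρ * negOnePow R (sExp η ρ) ≈ negOnePow R (sExp η σ) * incidence R (σ ─ η) (ρ ─ η)
  incidence-sign-exchange {η = η} {ρ} {σ} η⊆ρ ρ⊆σ = begin
    incidence R σ ρ * negOnePow R (sExp η ρ)
      ≈⟨ negOnePow-+ (incExp σ ρ) (sExp η ρ) ⟨
    negOnePow R (incExp σ ρ + sExp η ρ)
      ≡⟨ cong (negOnePow R) (incExp-sExp-exchange η⊆ρ ρ⊆σ) ⟩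
    negOnePow R (sExp η σ + incExp (σ ─ η) (ρ ─ η))
      ≈⟨ negOnePow-+ (sExp η σ) (incExp (σ ─ η) (ρ ─ η)) ⟩
    negOnePow R (sExp η σ) * incidence R (σ ─ η) (ρ ─ η) ∎

lemma4p6 : ∀ {a b : Level} (R : CommutativeRing a b) (n : ℕ) (X : Subset n → Set)
    → IsSimplicialComplex X
    → (l k : ℕ) → l < k
    → (η σ τ : Subset n)
    → InX X l η → InXη X η k σ → InXη X η k τ
    → ∣ σ ∩ τ ∣ ≡ k
    → (r : CommutativeRing.Carrier R)
    → CommutativeRing._≈_ R (CommutativeRing._*_ R (CommutativeRing._*_ R r r) (natR R (suc k C suc l))) (CommutativeRing.1# R)
    → CommutativeRing._≈_ R
        (CommutativeRing._*_ R (incidence R σ (σ ∩ τ)) (incidence R τ (σ ∩ τ)))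
        (CommutativeRing._*_ R
          (CommutativeRing._*_ R
            (CommutativeRing._*_ R (natR R (suc k C suc l))
              (CommutativeRing._*_ R (sη R r η σ) (sη R r η τ)))
            (incidence R (σ ─ η) ((σ ∩ τ) ─ η)))
          (incidence R (τ ─ η) ((σ ∩ τ) ─ η)))
lemma4p6 R n _ _ l k _ η σ τ _ (_ , η⊆σ) (_ , η⊆τ) _ r r²K≈1 = begin
  iσ * iτ                                    ≈⟨ x*y≈[x*u]*[y*u] iσ iτ (negOnePow-square (sExp η ρ)) ⟩
  (iσ * sign ρ) * (iτ * sign ρ)              ≈⟨ *-cong (incidence-sign-exchange η⊆ρ (p∩q⊆p σ τ))
                                                       (incidence-sign-exchange η⊆ρ (p∩q⊆q σ τ)) ⟩
  (sign σ * jσ) * (sign τ * jτ)              ≈⟨ interchange (sign σ) jσ (sign τ) jτ ⟩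
  (sign σ * sign τ) * (jσ * jτ)              ≈⟨ *-assoc (sign σ * sign τ) jσ jτ ⟨
  ((sign σ * sign τ) * jσ) * jτ              ≈⟨ *-congʳ (*-congʳ (K*[r*x*[r*y]]≈x*y (sign σ) (sign τ) r²K≈1)) ⟨
  ((K * (sη R r η σ * sη R r η τ)) * jσ) * jτ ∎
  where
  open CommutativeRing R
  open Signs R
  open import Algebra.Properties.CommutativeSemigroup *-commutativeSemigroup using (interchange)
  open import Relation.Binary.Reasoning.Setoid setoid
  ρ : Subset n
  ρ = σ ∩ τ
  η⊆ρ : η ⊆ ρ
  η⊆ρ x∈η = x∈p∩q⁺ (η⊆σ x∈η , η⊆τ x∈η)
  K iσ iτ jσ jτ : Carrier
  K = natR R (suc k C suc l)
  sign : Subset n → Carrier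
  sign = negOnePow R ∘ sExp η
  iσ = incidence R σ ρ
  iτ = incidence R τ ρ
  jσ = incidence R (σ ─ η) (ρ ─ η)
  jτ = incidence R (τ ─ η) (ρ ─ η)
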